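{- Fix integers $1\le p\le n$, a $p$-element subset $Y=\{y_1<\dots<y_p\}\subseteq[n]$, and $w=w_1\dots w_n\in\mathfrak S_n$ with $Y\le\{w_1,\dots,w_p\}$. Let $\sigma\in\mathfrak S_n$ be the permutation produced by the maximal-lift procedure described in the context. Then: (1) $\{\sigma_1,\dots,\sigma_p\}=Y$ and $\sigma\le w$ in Bruhat order; (2) if $v\in\mathfrak S_n$ satisfies $\{v_1,\dots,v_p\}=Y$ and $v\not\le\sigma$, then $v\not\le w$. (Consequently $\sigma$ is the unique maximal element of $\{v\in\mathfrak S_n:\{v_1,\dots,v_p\}=Y,\ v\le w\}$.)
   Context: For $t$-element subsets $E,F\subseteq[n]$, $E\le F$ means the $k$-th smallest element of $E$ is $\le$ the $k$-th smallest of $F$ for all $k$; $\tilde e_k$ denotes the $k$-th smallest element of $E$. For permutations in one-line notation, $u\le v$ in Bruhat order iff $\{u_1,\dots,u_i\}\le\{v_1,\dots,v_i\}$ for all $1\le i\le n$. Sub-procedure $P$: inputs are $t$-element subsets $A,B\subseteq[n]$ with $B\le A$ and an element $\gamma\in[n]\setminus A$. Put $A'=A\cup\{\gamma\}$, let $q$ be the least index, $1\le q\le t+1$, with $\tilde b_q\not\le\tilde a'_q$ (where $\tilde b_{t+1}=\infty$), output $a':=\tilde a'_q$, and update $A,B$ to $A'$ and $B':=B\cup\{a'\}$. Maximal-lift procedure: for $1\le j\le p$, $\sigma_j$ is the maximum element of $Y\setminus\{\sigma_1,\dots,\sigma_{j-1}\}$ not exceeding $w_j$. For $j=p+1$, run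 $P$ with $A=\{w_1,\dots,w_p\}$, $B=Y$, $\gamma=w_{p+1}$ and let $\sigma_{p+1}$ be its output; for $j>p+1$, run $P$ with $A,B$ the updated sets from the previous run and $\gamma=w_j$, and let $\sigma_j$ be its output. -}

module Defs where

open import Data.Nat using (ℕ; zero; suc; _≤_; _≤ᵇ_; _⊔_; _≤?_)
open import Data.Nat.Properties using (≤-decTotalOrder)
open import Data.List using (List; []; _∷_; map; upTo; take; drop; filter; foldr; _++_; length)
open import Data.List.Relation.Binary.Pointwise using (Pointwise)
open import Data.List.Relation.Binary.Permutation.Propositional using (_↭_)
open import Data.List.Membership.DecPropositional (Data.Nat._≟_) using (_∈?_)
open import Data.Bool using (if_then_else_)
open import Relation.Nullary using (¬?; yes; no)
open import Data.List.Sort ≤-decTotalOrder using (sort)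

oneTo : ℕ → List ℕ
oneTo n = map suc (upTo n)

IsPerm : ℕ → List ℕ → Set
IsPerm n w = w ↭ oneTo n

-- Order on t-element subsets (given as duplicate-free lists):
-- E ≤ F iff the k-th smallest element of E is ≤ the k-th smallest of F
-- for all k (sorted lists compared pointwise; forces equal size).
_≤ₛ_ : List ℕ → List ℕ → Set
E ≤ₛ F = Pointwise _≤_ (sort E) (sort F)

BruhatLE : ℕ → List ℕ → List ℕ → Set
BruhatLE n u v = ∀ i → 1 ≤ i → i ≤ n → take i u ≤ₛ take i v

-- maximum element of L not exceeding x (0 if there is none; elements are ≥ 1)
maxLE : ℕ → List ℕ → ℕ
maxLE x = foldr (λ y m → if y ≤ᵇ x then y ⊔ m else m) 0

phase1 : List ℕ → List ℕ → List ℕ → List ℕ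
phase1 Y [] prev = []
phase1 Y (x ∷ ws) prev =
  let s = maxLE x (filter (λ y → ¬? (y ∈? prev)) Y) in s ∷ phase1 Y ws (s ∷ prev)

-- Given sorted b̃ (length t) and sorted ã' (length t+1): ã'_q for the least q
-- with b̃_q ≰ ã'_q, where b̃_{t+1} = ∞.
firstViol : List ℕ → List ℕ → ℕ
firstViol (b ∷ bs) (a ∷ as) with b ≤? a
... | yes _ = firstViol bs as
... | no _  = a
firstViol [] (a ∷ as) = a
firstViol _ [] = 0

procP : List ℕ → List ℕ → ℕ → ℕ
procP A B γ = firstViol (sort B) (sort (γ ∷ A))

phase2 : List ℕ → List ℕ → List ℕ → List ℕ
phase2 A B [] = []
phase2 A B (γ ∷ ws) = let a = procP A B γ in a ∷ phase2 (γ ∷ A) (a ∷ B) ws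

maxLift : ℕ → List ℕ → List ℕ → List ℕ
maxLift p Y w = phase1 Y (take p w) [] ++ phase2 (take p w) Y (drop p w)

-- Compare sets through the counting functions #≥ k E = #{e ∈ E | e ≥ k}: for sets of equal size,
-- E ≤ F holds exactly when #≥ k E ≤ #≥ k F for every k, and lists with the same counts are
-- permutations of each other.  In these terms both phases of the maximal lift keep a simple
-- invariant.  In the greedy phase (j ≤ p) the values chosen so far form the greatest sub-multiset
-- of Y lying below w₁…w_j.  In the phase driven by P (j = p + i) the prefix σ₁…σ_j has the counts
--   k ↦ #≥ k Y + min_{l ≤ k} (#≥ l (w₁…w_j) − #≥ l Y),
-- the greatest ones among lists below w₁…w_j that are at least as dense as Y on every interval
-- [l, k); every list whose first p entries form Y is of that kind.  Hence, prefix by prefix, σ is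
-- below w, and every v whose first p entries form Y and which is below w is also below σ.  The
-- permutation w is itself dense (Y ⊆ [n] has no repetitions), so w is below σ, which makes σ a
-- permutation.

module Submission where

open import Defs
open import Data.Bool using (true; false; T)
open import Data.Empty using (⊥-elim)
open import Data.Unit using (tt)
open import Data.Nat using (ℕ; zero; suc; _+_; _∸_; _⊓_; _≤_; _<_; z≤n; s≤s; _≤ᵇ_)
open import Data.Nat.Properties
open import Data.Nat.Tactic.RingSolver using (solve-∀)
open import Data.Product using (∃-syntax; _×_; _,_; proj₁; proj₂)
open import Data.Sum using (_⊎_; inj₁; inj₂)
open import Data.List using (List; []; _∷_; length; _++_; take; drop; map; upTo; filter)
open import Data.List.Properties
  using (upTo-∷ʳ; filter-accept; filter-reject; filter-all; length-map; length-upTo; length-++; length-drop;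
         length-take; take-all; take-take; take-[]; take++drop≡id)
open import Data.List.Membership.Propositional using (_∈_; _∉_)
open import Data.List.Membership.DecPropositional _≟_ using (_∈?_)
open import Data.List.Relation.Binary.Permutation.Propositional as ↭
  using (_↭_; ↭-refl; ↭-reflexive; ↭-sym; ↭-trans; prep; swap)
open import Data.List.Relation.Binary.Permutation.Propositional.Properties
  using (↭-length; shift; ++⁺ʳ; ++-identityʳ)
open import Data.List.Relation.Binary.Pointwise using (Pointwise; []; _∷_; Pointwise-≡⇒≡)
open import Data.List.Relation.Binary.Pointwise.Properties using (antisymmetric)
open import Data.List.Relation.Unary.All as All using (All; []; _∷_)
open import Data.List.Relation.Unary.All.Properties using (filter⁺)
open import Data.List.Relation.Unary.AllPairs using ([]; _∷_)
open import Data.List.Relation.Unary.Any using (here; there)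
open import Data.List.Relation.Unary.Linked using (Linked; _∷_; tail)
open import Data.List.Relation.Unary.Unique.Propositional using (Unique)
open import Data.List.Sort ≤-decTotalOrder using (sort; sort-↭; sort-↗)
open import Relation.Binary.PropositionalEquality as ≡ using (_≡_; _≢_; cong; cong₂; sym; subst; subst₂)
open import Function using (_∘_)
open import Relation.Nullary using (¬_; ¬?; Dec; yes; no; contradiction)
open import Relation.Nullary.Decidable using (toSum)

-- Counting entries above a threshold

χ≥ : ℕ → ℕ → ℕ
χ≥ k x with k ≤? x
... | yes _ = 1
... | no  _ = 0

#≥ : ℕ → List ℕ → ℕ
#≥ k []       = 0
#≥ k (x ∷ xs) = χ≥ k x + #≥ k xs

infix 4 _≤#_
_≤#_ : List ℕ → List ℕ → Set
xs ≤# ys = ∀ k → #≥ k xs ≤ #≥ k ys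

χ≥-≤ : ∀ {k x} → k ≤ x → χ≥ k x ≡ 1
χ≥-≤ {k} {x} k≤x with k ≤? x
... | yes _   = ≡.refl
... | no  k≰x = contradiction k≤x k≰x

χ≥-> : ∀ {k x} → x < k → χ≥ k x ≡ 0
χ≥-> {k} {x} x<k with k ≤? x
... | yes k≤x = contradiction k≤x (<⇒≱ x<k)
... | no  _   = ≡.refl

χ≥≤1 : ∀ k x → χ≥ k x ≤ 1
χ≥≤1 k x with ≤-<-connex k x
... | inj₁ k≤x = ≤-reflexive (χ≥-≤ k≤x)
... | inj₂ x<k = ≤-trans (≤-reflexive (χ≥-> x<k)) z≤n

χ≥-antitone : ∀ {k l} x → k ≤ l → χ≥ l x ≤ χ≥ k x
χ≥-antitone {k} {l} x k≤l with ≤-<-connex l x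
... | inj₁ l≤x = ≤-reflexive (≡.trans (χ≥-≤ l≤x) (sym (χ≥-≤ (≤-trans k≤l l≤x))))
... | inj₂ x<l = ≤-trans (≤-reflexive (χ≥-> x<l)) z≤n

χ≥-monotone : ∀ k {x y} → x ≤ y → χ≥ k x ≤ χ≥ k y
χ≥-monotone k {x} x≤y with ≤-<-connex k x
... | inj₁ k≤x = ≤-reflexive (≡.trans (χ≥-≤ k≤x) (sym (χ≥-≤ (≤-trans k≤x x≤y))))
... | inj₂ x<k = ≤-trans (≤-reflexive (χ≥-> x<k)) z≤n

χ≥-suc : ∀ k x → χ≥ (suc k) (suc x) ≡ χ≥ k x
χ≥-suc k x with ≤-<-connex k x
... | inj₁ k≤x = ≡.trans (χ≥-≤ (s≤s k≤x)) (sym (χ≥-≤ k≤x))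
... | inj₂ x<k = ≡.trans (χ≥-> (s≤s x<k)) (sym (χ≥-> x<k))

χ≥-≢ : ∀ {k x} → k ≢ x → χ≥ k x ≡ χ≥ (suc k) x
χ≥-≢ {k} {x} k≢x with ≤-<-connex k x
... | inj₁ k≤x = ≡.trans (χ≥-≤ k≤x) (sym (χ≥-≤ (≤∧≢⇒< k≤x k≢x)))
... | inj₂ x<k = ≡.trans (χ≥-> x<k) (sym (χ≥-> (m<n⇒m<1+n x<k)))

#≥-++ : ∀ k xs ys → #≥ k (xs ++ ys) ≡ #≥ k xs + #≥ k ys
#≥-++ k []       ys = ≡.refl
#≥-++ k (x ∷ xs) ys = ≡.trans (cong (χ≥ k x +_) (#≥-++ k xs ys)) (sym (+-assoc (χ≥ k x) _ _))

#≥-antitone : ∀ {k l} xs → k ≤ l → #≥ l xs ≤ #≥ k xs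
#≥-antitone []       k≤l = z≤n
#≥-antitone (x ∷ xs) k≤l = +-mono-≤ (χ≥-antitone x k≤l) (#≥-antitone xs k≤l)

#≥≤length : ∀ k xs → #≥ k xs ≤ length xs
#≥≤length k []       = z≤n
#≥≤length k (x ∷ xs) = +-mono-≤ (χ≥≤1 k x) (#≥≤length k xs)

#≥-zero : ∀ xs → #≥ 0 xs ≡ length xs
#≥-zero []       = ≡.refl
#≥-zero (x ∷ xs) = cong₂ _+_ (χ≥-≤ {x = x} z≤n) (#≥-zero xs)

#≥-one : ∀ {xs} → All (1 ≤_) xs → #≥ 1 xs ≡ length xs
#≥-one []         = ≡.refl
#≥-one (1≤x ∷ xs) = cong₂ _+_ (χ≥-≤ 1≤x) (#≥-one xs)

#≥-↭ : ∀ k {xs ys} → xs ↭ ys → #≥ k xs ≡ #≥ k ys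
#≥-↭ k ↭.refl              = ≡.refl
#≥-↭ k (prep x xs↭ys)    = cong (χ≥ k x +_) (#≥-↭ k xs↭ys)
#≥-↭ k (swap x y xs↭ys)  = ≡.trans (sym (+-assoc (χ≥ k x) _ _))
  (≡.trans (cong₂ _+_ (+-comm (χ≥ k x) _) (#≥-↭ k xs↭ys)) (+-assoc (χ≥ k y) _ _))
#≥-↭ k (↭.trans xs↭ys ys↭zs) = ≡.trans (#≥-↭ k xs↭ys) (#≥-↭ k ys↭zs)

#≥-oneTo : ∀ k n → #≥ (suc k) (oneTo n) ≡ n ∸ k
#≥-oneTo k n = ≡.trans (#≥-map-suc (upTo n)) (#≥-upTo n)
  where
  #≥-map-suc : ∀ xs → #≥ (suc k) (map suc xs) ≡ #≥ k xs
  #≥-map-suc []       = ≡.refl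
  #≥-map-suc (x ∷ xs) = cong₂ _+_ (χ≥-suc k x) (#≥-map-suc xs)
  χ≥+∸ : ∀ m → m ∸ k + χ≥ k m ≡ suc m ∸ k
  χ≥+∸ m with ≤-<-connex k m
  ... | inj₁ k≤m rewrite χ≥-≤ k≤m = ≡.trans (+-comm (m ∸ k) 1) (sym (+-∸-assoc 1 k≤m))
  ... | inj₂ m<k rewrite χ≥-> m<k | m≤n⇒m∸n≡0 (<⇒≤ m<k) = sym (m≤n⇒m∸n≡0 m<k)
  #≥-upTo : ∀ m → #≥ k (upTo m) ≡ m ∸ k
  #≥-upTo zero    = sym (0∸n≡0 k)
  #≥-upTo (suc m) = begin
    #≥ k (upTo (suc m))        ≡⟨ cong (#≥ k) (sym (upTo-∷ʳ m)) ⟩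
    #≥ k (upTo m ++ m ∷ [])    ≡⟨ #≥-++ k (upTo m) (m ∷ []) ⟩
    #≥ k (upTo m) + (χ≥ k m + 0) ≡⟨ cong₂ _+_ (#≥-upTo m) (+-identityʳ (χ≥ k m)) ⟩
    m ∸ k + χ≥ k m             ≡⟨ χ≥+∸ m ⟩
    suc m ∸ k                  ∎
    where open ≡.≡-Reasoning

#≥-∈ : ∀ {x xs} → x ∈ xs → suc (#≥ (suc x) xs) ≤ #≥ x xs
#≥-∈ {x} {_ ∷ xs} (here ≡.refl) rewrite χ≥-≤ {x} ≤-refl | χ≥-> {suc x} ≤-refl =
  s≤s (#≥-antitone xs (n≤1+n x))
#≥-∈ {x} {y ∷ xs} (there x∈xs) =
  ≤-trans (≤-reflexive (sym (+-suc (χ≥ (suc x) y) _))) (+-mono-≤ (χ≥-antitone y (n≤1+n x)) (#≥-∈ x∈xs))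

#≥-∉ : ∀ {k xs} → k ∉ xs → #≥ k xs ≡ #≥ (suc k) xs
#≥-∉ {k} {[]}     k∉xs = ≡.refl
#≥-∉ {k} {x ∷ xs} k∉xs = cong₂ _+_ (χ≥-≢ (λ k≡x → k∉xs (here k≡x))) (#≥-∉ (λ k∈xs → k∉xs (there k∈xs)))

#≥-unique : ∀ {xs} → Unique xs → ∀ k → #≥ k xs ≤ suc (#≥ (suc k) xs)
#≥-unique {[]}     []           k = z≤n
#≥-unique {x ∷ xs} (x∉xs ∷ uxs) k with k ≟ x
... | yes ≡.refl rewrite χ≥-≤ {k} ≤-refl | χ≥-> {suc k} ≤-refl
    = ≤-reflexive (cong suc (#≥-∉ (λ k∈xs → All.lookup x∉xs k∈xs ≡.refl)))
... | no k≢x rewrite χ≥-≢ k≢x = ≤-trans (+-monoʳ-≤ (χ≥ (suc k) x) (#≥-unique uxs k)) (≤-reflexive (+-suc _ _))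

↭⇒≤# : ∀ {xs ys} → xs ↭ ys → xs ≤# ys
↭⇒≤# xs↭ys k = ≤-reflexive (#≥-↭ k xs↭ys)

-- The order on sets through counts

Sorted : List ℕ → Set
Sorted = Linked _≤_

#≥-sorted-head : ∀ {x xs} → Sorted (x ∷ xs) → ∀ {k} → k ≤ x → #≥ k (x ∷ xs) ≡ suc (length xs)
#≥-sorted-head {x} {[]}     _           k≤x = cong (_+ 0) (χ≥-≤ k≤x)
#≥-sorted-head {x} {y ∷ xs} (x≤y ∷ sxs) k≤x =
  cong₂ _+_ (χ≥-≤ k≤x) (#≥-sorted-head sxs (≤-trans k≤x x≤y))

Pointwise⇒≤# : ∀ {xs ys} → Pointwise _≤_ xs ys → xs ≤# ys
Pointwise⇒≤# []               k = z≤n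
Pointwise⇒≤# (x≤y ∷ xs≤ys) k = +-mono-≤ (χ≥-monotone k x≤y) (Pointwise⇒≤# xs≤ys k)

≤#⇒Pointwise : ∀ {xs ys} → Sorted xs → Sorted ys → length xs ≡ length ys →
               xs ≤# ys → Pointwise _≤_ xs ys
≤#⇒Pointwise {[]}     {[]}     _  _  _   _ = []
≤#⇒Pointwise {x ∷ xs} {y ∷ ys} sx sy len h = x≤y ∷ ≤#⇒Pointwise (tail sx) (tail sy) len′ h′
  where
  len′ : length xs ≡ length ys
  len′ = suc-injective len
  x≤y : x ≤ y
  x≤y with ≤-<-connex x y
  ... | inj₁ x≤y = x≤y
  ... | inj₂ y<x = contradiction (h x) (<⇒≱ (begin-strict
    #≥ x (y ∷ ys)      ≡⟨ cong (_+ #≥ x ys) (χ≥-> y<x) ⟩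
    #≥ x ys            ≤⟨ #≥≤length x ys ⟩
    length ys          ≡⟨ sym len′ ⟩
    length xs          <⟨ ≤-refl ⟩
    suc (length xs)    ≡⟨ sym (#≥-sorted-head sx ≤-refl) ⟩
    #≥ x (x ∷ xs)      ∎))
    where open ≤-Reasoning
  h′ : ∀ k → #≥ k xs ≤ #≥ k ys
  h′ k with ≤-<-connex k x | ≤-<-connex k y
  ... | inj₁ k≤x | _ = +-cancelˡ-≤ 1 _ _
    (subst₂ (λ a b → a + #≥ k xs ≤ b + #≥ k ys) (χ≥-≤ k≤x) (χ≥-≤ (≤-trans k≤x x≤y)) (h k))
  ... | inj₂ x<k | inj₁ k≤y = begin
    #≥ k xs   ≤⟨ #≥≤length k xs ⟩
    length xs ≡⟨ len′ ⟩
    length ys ≡⟨ suc-injective (≡.trans (sym (#≥-sorted-head sy k≤y)) (cong (_+ #≥ k ys) (χ≥-≤ k≤y))) ⟩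
    #≥ k ys   ∎
    where open ≤-Reasoning
  ... | inj₂ x<k | inj₂ y<k =
    subst₂ (λ a b → a + #≥ k xs ≤ b + #≥ k ys) (χ≥-> x<k) (χ≥-> y<k) (h k)

#≥-sort : ∀ k xs → #≥ k (sort xs) ≡ #≥ k xs
#≥-sort k xs = #≥-↭ k (sort-↭ xs)

≤ₛ⇒≤# : ∀ {E F} → E ≤ₛ F → E ≤# F
≤ₛ⇒≤# {E} {F} E≤F k = subst₂ _≤_ (#≥-sort k E) (#≥-sort k F) (Pointwise⇒≤# E≤F k)

≤#⇒≤ₛ : ∀ {E F} → length E ≡ length F → E ≤# F → E ≤ₛ F
≤#⇒≤ₛ {E} {F} len h = ≤#⇒Pointwise (sort-↗ E) (sort-↗ F)
  (≡.trans (↭-length (sort-↭ E)) (≡.trans len (sym (↭-length (sort-↭ F)))))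
  (λ k → subst₂ _≤_ (sym (#≥-sort k E)) (sym (#≥-sort k F)) (h k))

#≥-≡⇒↭ : ∀ {xs ys} → (∀ k → #≥ k xs ≡ #≥ k ys) → xs ↭ ys
#≥-≡⇒↭ {xs} {ys} h = ↭-trans (↭-sym (sort-↭ xs)) (subst (_↭ ys) (sym sort≡) (sort-↭ ys))
  where
  len : length xs ≡ length ys
  len = ≡.trans (sym (#≥-zero xs)) (≡.trans (h 0) (#≥-zero ys))
  sort≡ : sort xs ≡ sort ys
  sort≡ = Pointwise-≡⇒≡ (antisymmetric ≤-antisym
    (≤#⇒≤ₛ len (λ k → ≤-reflexive (h k))) (≤#⇒≤ₛ (sym len) (λ k → ≤-reflexive (sym (h k)))))

-- The sub-procedure P

head≤firstViol : ∀ bs {a as} → Sorted (a ∷ as) → length as ≡ length bs → a ≤ firstViol bs (a ∷ as)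
head≤firstViol []       _ _ = ≤-refl
head≤firstViol (b ∷ bs) {a} s len with b ≤? a
... | no _ = ≤-refl
head≤firstViol (b ∷ bs) {a} {_ ∷ _} (a≤a₂ ∷ s) len | yes _ =
  ≤-trans a≤a₂ (head≤firstViol bs s (suc-injective len))

#≥-below-firstViol : ∀ bs as → Sorted as → length as ≡ suc (length bs) →
                     ∀ k → k ≤ firstViol bs as → suc (#≥ k bs) ≤ #≥ k as
#≥-below-firstViol []       (a ∷ as) _ _   k k≤a rewrite χ≥-≤ k≤a = s≤s z≤n
#≥-below-firstViol (b ∷ bs) (a ∷ as) s len k k≤v with b ≤? a
... | yes b≤a = subst (_≤ χ≥ k a + #≥ k as) (+-suc (χ≥ k b) (#≥ k bs))
  (+-mono-≤ (χ≥-monotone k b≤a) (#≥-below-firstViol bs as (tail s) (suc-injective len) k k≤v))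
... | no _ = begin
  suc (#≥ k (b ∷ bs))   ≤⟨ s≤s (#≥≤length k (b ∷ bs)) ⟩
  suc (length (b ∷ bs)) ≡⟨ cong suc (sym (suc-injective len)) ⟩
  suc (length as)       ≡⟨ sym (#≥-sorted-head s k≤v) ⟩
  #≥ k (a ∷ as)         ∎
  where open ≤-Reasoning

#≥-above-firstViol : ∀ bs as → Sorted bs → Sorted as → length as ≡ suc (length bs) →
                     #≥ (suc (firstViol bs as)) as ≤ #≥ (suc (firstViol bs as)) bs
#≥-above-firstViol []       (a ∷ []) _ _ _ rewrite χ≥-> {suc a} {a} ≤-refl = z≤n
#≥-above-firstViol (b ∷ bs) (a ∷ as) sb sa len with b ≤? a
... | no b≰a rewrite χ≥-> {suc a} {a} ≤-refl = begin
  #≥ (suc a) as       ≤⟨ #≥≤length (suc a) as ⟩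
  length as           ≡⟨ suc-injective len ⟩
  suc (length bs)     ≡⟨ sym (#≥-sorted-head sb (≰⇒> b≰a)) ⟩
  #≥ (suc a) (b ∷ bs) ∎
  where open ≤-Reasoning
... | yes _ with as | sa | len
...   | a₂ ∷ as₂ | a≤a₂ ∷ sa₂ | len₂
  rewrite χ≥-> {suc (firstViol bs (a₂ ∷ as₂))} {a}
            (s≤s (≤-trans a≤a₂ (head≤firstViol bs sa₂ (suc-injective (suc-injective len₂))))) =
  ≤-trans (#≥-above-firstViol bs (a₂ ∷ as₂) (tail sb) sa₂ (suc-injective len₂)) (m≤n+m _ _)

length-sort-step : ∀ {A B : List ℕ} γ → length B ≡ length A → length (sort (γ ∷ A)) ≡ suc (length (sort B))
length-sort-step {A} {B} γ len =
  ≡.trans (↭-length (sort-↭ (γ ∷ A))) (cong suc (≡.trans (sym len) (sym (↭-length (sort-↭ B)))))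

#≥-below-procP : ∀ {A B} γ → length B ≡ length A →
                 ∀ k → k ≤ procP A B γ → suc (#≥ k B) ≤ χ≥ k γ + #≥ k A
#≥-below-procP {A} {B} γ len k k≤a = subst₂ (λ u v → suc u ≤ v) (#≥-sort k B) (#≥-sort k (γ ∷ A))
  (#≥-below-firstViol (sort B) (sort (γ ∷ A)) (sort-↗ (γ ∷ A)) (length-sort-step γ len) k k≤a)

#≥-above-procP : ∀ {A B} γ → length B ≡ length A → let k = suc (procP A B γ) in
                 χ≥ k γ + #≥ k A ≤ #≥ k B
#≥-above-procP {A} {B} γ len = subst₂ _≤_ (#≥-sort _ (γ ∷ A)) (#≥-sort _ B)
  (#≥-above-firstViol (sort B) (sort (γ ∷ A)) (sort-↗ B) (sort-↗ (γ ∷ A)) (length-sort-step γ len))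

-- The greedy choice

maxLE-cases : ∀ x L → maxLE x L ≡ 0 ⊎ (maxLE x L ∈ L × maxLE x L ≤ x)
maxLE-cases x []      = inj₁ ≡.refl
maxLE-cases x (y ∷ L) with y ≤ᵇ x in y≤ᵇx | maxLE-cases x L
... | false | inj₁ m≡0         = inj₁ m≡0
... | false | inj₂ (m∈L , m≤x) = inj₂ (there m∈L , m≤x)
... | true  | found with ⊔-sel y (maxLE x L)
...   | inj₁ y⊔m≡y rewrite y⊔m≡y = inj₂ (here ≡.refl , ≤ᵇ⇒≤ y x (≡.subst T (sym y≤ᵇx) tt))
...   | inj₂ y⊔m≡m rewrite y⊔m≡m with found
...     | inj₁ m≡0         = inj₁ m≡0
...     | inj₂ (m∈L , m≤x) = inj₂ (there m∈L , m≤x)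

maxLE-greatest : ∀ x L {y} → y ∈ L → y ≤ x → y ≤ maxLE x L
maxLE-greatest x (z ∷ L) (here ≡.refl) y≤x with z ≤ᵇ x in z≤ᵇx
... | true  = m≤m⊔n z (maxLE x L)
... | false = ⊥-elim (≡.subst T z≤ᵇx (≤⇒≤ᵇ y≤x))
maxLE-greatest x (z ∷ L) (there y∈L) y≤x with z ≤ᵇ x
... | true  = ≤-trans (maxLE-greatest x L y∈L y≤x) (m≤n⊔m z (maxLE x L))
... | false = maxLE-greatest x L y∈L y≤x

#≥-constant-above : ∀ L x s → (∀ {y} → y ∈ L → y ≤ x → y ≤ s) →
                    ∀ k → suc s ≤ k → k ≤ suc x → #≥ k L ≡ #≥ (suc x) L
#≥-constant-above []      x s h k s<k k≤x+1 = ≡.refl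
#≥-constant-above (y ∷ L) x s h k s<k k≤x+1 =
  cong₂ _+_ χ≥≡ (#≥-constant-above L x s (λ y∈L → h (there y∈L)) k s<k k≤x+1)
  where
  χ≥≡ : χ≥ k y ≡ χ≥ (suc x) y
  χ≥≡ with ≤-<-connex y x
  ... | inj₁ y≤x = ≡.trans (χ≥-> (≤-<-trans (h (here ≡.refl) y≤x) s<k)) (sym (χ≥-> (s≤s y≤x)))
  ... | inj₂ x<y = ≡.trans (χ≥-≤ (≤-trans k≤x+1 x<y)) (sym (χ≥-≤ x<y))

∉-∷ : ∀ {y s : ℕ} {xs} → y ≢ s → y ∉ xs → y ∉ s ∷ xs
∉-∷ y≢s y∉xs (here y≡s)   = y≢s y≡s
∉-∷ y≢s y∉xs (there y∈xs) = y∉xs y∈xs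

_∉?_ : ∀ (y : ℕ) xs → Dec (y ∉ xs)
y ∉? xs = ¬? (y ∈? xs)

infixl 5 _∖_
_∖_ : List ℕ → List ℕ → List ℕ
L ∖ xs = filter (_∉? xs) L

∖-[] : ∀ L → L ∖ [] ≡ L
∖-[] L = filter-all (_∉? []) (All.universal (λ _ ()) L)

∖-∷-fresh : ∀ {s} prev L → All (s ≢_) L → L ∖ prev ≡ L ∖ (s ∷ prev)
∖-∷-fresh         prev []      []           = ≡.refl
∖-∷-fresh {s} prev (y ∷ L) (s≢y ∷ s≢L) with toSum (y ∈? prev)
... | inj₁ y∈prev rewrite filter-reject (_∉? prev) {y} {L} (λ y∉ → y∉ y∈prev)
                        | filter-reject (_∉? (s ∷ prev)) {y} {L} (λ y∉ → y∉ (there y∈prev))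
    = ∖-∷-fresh prev L s≢L
... | inj₂ y∉prev rewrite filter-accept (_∉? prev) {y} {L} y∉prev
                        | filter-accept (_∉? (s ∷ prev)) {y} {L} (∉-∷ (s≢y ∘ sym) y∉prev)
    = cong (y ∷_) (∖-∷-fresh prev L s≢L)

∖-∷-↭ : ∀ {L} → Unique L → ∀ {s} prev → s ∈ L ∖ prev → L ∖ prev ↭ s ∷ (L ∖ (s ∷ prev))
∖-∷-↭ {y ∷ L} (y∉L ∷ uL) {s} prev s∈ with toSum (y ∈? prev)
... | inj₁ y∈prev rewrite filter-reject (_∉? prev) {y} {L} (λ y∉ → y∉ y∈prev)
                        | filter-reject (_∉? (s ∷ prev)) {y} {L} (λ y∉ → y∉ (there y∈prev))
    = ∖-∷-↭ uL prev s∈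
... | inj₂ y∉prev rewrite filter-accept (_∉? prev) {y} {L} y∉prev with y ≟ s
...   | yes ≡.refl rewrite filter-reject (_∉? (y ∷ prev)) {y} {L} (λ y∉ → y∉ (here ≡.refl))
      = prep y (↭-reflexive (∖-∷-fresh prev L y∉L))
...   | no  y≢s rewrite filter-accept (_∉? (s ∷ prev)) {y} {L} (∉-∷ y≢s y∉prev)
      = ↭-trans (prep y (∖-∷-↭ uL prev (tail-∈ s∈))) (swap y s ↭-refl)
  where
  tail-∈ : s ∈ y ∷ (L ∖ prev) → s ∈ L ∖ prev
  tail-∈ (here s≡y)  = ⊥-elim (y≢s (sym s≡y))
  tail-∈ (there s∈) = s∈

-- The phase driven by P

module _ (Y : List ℕ) where

  Denser : List ℕ → Set
  Denser V = ∀ {l k} → l ≤ k → #≥ k V + #≥ l Y ≤ #≥ l V + #≥ k Y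

  Below : List ℕ → List ℕ → Set
  Below A B = ∀ {l k} → l ≤ k → #≥ k B + #≥ l Y ≤ #≥ l A + #≥ k Y

  TightAt : List ℕ → List ℕ → ℕ → ℕ → Set
  TightAt A B l k = #≥ k B + #≥ l Y ≡ #≥ l A + #≥ k Y

  Denser-steps : ∀ {V} → (∀ j → #≥ (suc j) V + #≥ j Y ≤ #≥ j V + #≥ (suc j) Y) → Denser V
  Denser-steps {V} step {l} {k} l≤k =
    subst (λ t → #≥ t V + #≥ l Y ≤ #≥ l V + #≥ t Y) (m∸n+n≡m l≤k) (telescope (k ∸ l))
    where
    telescope : ∀ m → #≥ (m + l) V + #≥ l Y ≤ #≥ l V + #≥ (m + l) Y
    telescope zero    = ≤-refl
    telescope (suc m) = +-cancelʳ-≤ (#≥ (m + l) V + #≥ (m + l) Y) _ _ (begin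
      (Vs + Yl) + (Vm + Ym)   ≡⟨ exchange Vs Yl Vm Ym ⟩
      (Vs + Ym) + (Vm + Yl)   ≤⟨ +-mono-≤ (step (m + l)) (telescope m) ⟩
      (Vm + Ys) + (Vl + Ym)   ≡⟨ exchange′ Vm Ys Vl Ym ⟩
      (Vl + Ys) + (Vm + Ym)   ∎)
      where
      open ≤-Reasoning
      Vs = #≥ (suc m + l) V
      Vm = #≥ (m + l) V
      Vl = #≥ l V
      Ys = #≥ (suc m + l) Y
      Ym = #≥ (m + l) Y
      Yl = #≥ l Y
      exchange : ∀ a b c d → (a + b) + (c + d) ≡ (a + d) + (c + b)
      exchange = solve-∀
      exchange′ : ∀ a b c d → (a + b) + (c + d) ≡ (c + b) + (a + d)
      exchange′ = solve-∀

  Denser-resp-↭ : ∀ {V V′} → V ↭ V′ → Denser V → Denser V′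
  Denser-resp-↭ {V} {V′} V↭V′ V-denser {l} {k} l≤k =
    subst₂ (λ u v → u + #≥ l Y ≤ v + #≥ k Y) (#≥-↭ k V↭V′) (#≥-↭ l V↭V′) (V-denser l≤k)

  Denser-⊇ : ∀ {V T} → V ↭ Y ++ T → Denser V
  Denser-⊇ {V} {T} V↭Y++T {l} {k} l≤k = begin
    #≥ k V + #≥ l Y                  ≡⟨ cong (_+ #≥ l Y) (≡.trans (#≥-↭ k V↭Y++T) (#≥-++ k Y T)) ⟩
    (#≥ k Y + #≥ k T) + #≥ l Y       ≡⟨ rotate (#≥ k Y) (#≥ k T) (#≥ l Y) ⟩
    (#≥ l Y + #≥ k T) + #≥ k Y       ≤⟨ +-monoˡ-≤ (#≥ k Y) (+-monoʳ-≤ (#≥ l Y) (#≥-antitone T l≤k)) ⟩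
    (#≥ l Y + #≥ l T) + #≥ k Y       ≡⟨ cong (_+ #≥ k Y) (sym (≡.trans (#≥-↭ l V↭Y++T) (#≥-++ l Y T))) ⟩
    #≥ l V + #≥ k Y                  ∎
    where
    open ≤-Reasoning
    rotate : ∀ a b c → (a + b) + c ≡ (c + b) + a
    rotate = solve-∀

  -- Envelope A B: B is denser than Y and #≥ k B = #≥ k Y + min_{l ≤ k} (#≥ l A − #≥ l Y),
  -- stated without subtraction: `below` bounds #≥ k B for every l ≤ k, `tight` names a minimiser.
  record Envelope (A B : List ℕ) : Set where
    field
      denser  : Denser B
      below   : Below A B
      tight   : ∀ k → ∃[ l ] l ≤ k × TightAt A B l k
      length≡ : length B ≡ length A

  open Envelope

  Envelope⇒≤# : ∀ {A B} → Envelope A B → B ≤# A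
  Envelope⇒≤# E k = +-cancelʳ-≤ _ _ _ (below E (≤-refl {k}))

  Envelope-maximal : ∀ {A B V} → Envelope A B → Denser V → V ≤# A → V ≤# B
  Envelope-maximal {A} {B} {V} E V-denser V≤A k with tight E k
  ... | l , l≤k , eq = +-cancelʳ-≤ (#≥ l Y) _ _ (begin
    #≥ k V + #≥ l Y ≤⟨ V-denser l≤k ⟩
    #≥ l V + #≥ k Y ≤⟨ +-monoˡ-≤ (#≥ k Y) (V≤A l) ⟩
    #≥ l A + #≥ k Y ≡⟨ sym eq ⟩
    #≥ k B + #≥ l Y ∎)
    where open ≤-Reasoning

  Envelope-resp-↭ : ∀ {A A′ B B′} → A ↭ A′ → B ↭ B′ → Envelope A B → Envelope A′ B′
  Envelope-resp-↭ {A} {A′} {B} {B′} A↭A′ B↭B′ E = record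
    { denser  = Denser-resp-↭ B↭B′ (denser E)
    ; below   = λ {l} {k} l≤k →
        subst₂ (λ u v → u + #≥ l Y ≤ v + #≥ k Y) (#≥-↭ k B↭B′) (#≥-↭ l A↭A′) (below E l≤k)
    ; tight   = λ k → let (l , l≤k , eq) = tight E k in
                  l , l≤k , subst₂ (λ u v → u + #≥ l Y ≡ v + #≥ k Y) (#≥-↭ k B↭B′) (#≥-↭ l A↭A′) eq
    ; length≡ = ≡.trans (sym (↭-length B↭B′)) (≡.trans (length≡ E) (↭-length A↭A′))
    }

  Envelope-base : ∀ {A} → length Y ≡ length A → Y ≤# A → Envelope A Y
  Envelope-base {A} len Y≤A = record
    { denser  = λ {l} {k} _ → ≤-reflexive (+-comm (#≥ k Y) (#≥ l Y))
    ; below   = λ {l} {k} _ →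
        subst (_≤ #≥ l A + #≥ k Y) (+-comm (#≥ l Y) (#≥ k Y)) (+-monoˡ-≤ (#≥ k Y) (Y≤A l))
    ; tight   = λ k → 0 , z≤n , ≡.trans (+-comm (#≥ k Y) (#≥ 0 Y))
                  (cong (_+ #≥ k Y) (≡.trans (#≥-zero Y) (≡.trans len (sym (#≥-zero A)))))
    ; length≡ = len
    }

  module EnvelopeStep {A B} (E : Envelope A B) (γ : ℕ) where

    private
      a = procP A B γ
      B-denser = denser E
      A-below  = below E

    step-denser : Denser (a ∷ B)
    step-denser {l} {k} l≤k = subst₂ _≤_ (sym (+-assoc (χ≥ k a) _ _)) (sym (+-assoc (χ≥ l a) _ _))
      (+-mono-≤ (χ≥-antitone a l≤k) (B-denser l≤k))

    step-below : Below (γ ∷ A) (a ∷ B)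
    step-below {l} {k} l≤k with ≤-<-connex k a
    ... | inj₁ k≤a rewrite χ≥-≤ k≤a = ≤-trans (s≤s (B-denser l≤k))
      (+-monoˡ-≤ (#≥ k Y) (#≥-below-procP γ (length≡ E) l (≤-trans l≤k k≤a)))
    ... | inj₂ a<k rewrite χ≥-> a<k = ≤-trans (A-below l≤k) (+-monoˡ-≤ (#≥ k Y) (m≤n+m (#≥ l A) (χ≥ l γ)))

    γ≤procP : γ ≤ a
    γ≤procP with ≤-<-connex γ a
    ... | inj₁ γ≤a = γ≤a
    ... | inj₂ a<γ = contradiction (Envelope⇒≤# E (suc a))
      (<⇒≱ (subst (λ t → t + #≥ (suc a) A ≤ #≥ (suc a) B) (χ≥-≤ a<γ) (#≥-above-procP γ (length≡ E))))

    step-tight : ∀ k → ∃[ l ] l ≤ k × TightAt (γ ∷ A) (a ∷ B) l k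
    step-tight k with tight E k | ≤-<-connex k a
    ... | l , l≤k , eq | inj₁ k≤a with ≤-<-connex l γ
    ...   | inj₁ l≤γ = l , l≤k , subst₂ (λ u v → (u + #≥ k B) + #≥ l Y ≡ (v + #≥ l A) + #≥ k Y)
                                   (sym (χ≥-≤ k≤a)) (sym (χ≥-≤ l≤γ)) (cong suc eq)
    ...   | inj₂ γ<l = contradiction (≤-reflexive (sym eq)) (<⇒≱
                         (subst₂ (λ u v → (u + #≥ k B) + #≥ l Y ≤ (v + #≥ l A) + #≥ k Y)
                                 (χ≥-≤ k≤a) (χ≥-> γ<l) (step-below l≤k)))
    step-tight k | l , l≤k , eq | inj₂ a<k with ≤-<-connex l a
    ...   | inj₂ a<l = l , l≤k , subst₂ (λ u v → (u + #≥ k B) + #≥ l Y ≡ (v + #≥ l A) + #≥ k Y)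
                                   (sym (χ≥-> a<k)) (sym (χ≥-> (≤-<-trans γ≤procP a<l))) eq
    ...   | inj₁ l≤a = suc a , a<k , ≤-antisym (step-below a<k) tight-bound
      where
      s = suc a
      shifted-below : #≥ s B + #≥ k Y ≤ #≥ k B + #≥ s Y
      shifted-below = +-cancelʳ-≤ (#≥ l Y) _ _ (begin
        #≥ s B + #≥ k Y + #≥ l Y   ≡⟨ swap-last (#≥ s B) _ _ ⟩
        #≥ s B + #≥ l Y + #≥ k Y   ≤⟨ +-monoˡ-≤ (#≥ k Y) (A-below (m≤n⇒m≤1+n l≤a)) ⟩
        #≥ l A + #≥ s Y + #≥ k Y   ≡⟨ swap-last (#≥ l A) _ _ ⟩
        #≥ l A + #≥ k Y + #≥ s Y   ≡⟨ cong (_+ #≥ s Y) (sym eq) ⟩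
        #≥ k B + #≥ l Y + #≥ s Y   ≡⟨ swap-last (#≥ k B) _ _ ⟩
        #≥ k B + #≥ s Y + #≥ l Y   ∎)
        where
        open ≤-Reasoning
        swap-last : ∀ x y z → x + y + z ≡ x + z + y
        swap-last = solve-∀
      tight-bound : (χ≥ s γ + #≥ s A) + #≥ k Y ≤ (χ≥ k a + #≥ k B) + #≥ s Y
      tight-bound rewrite χ≥-> a<k = ≤-trans (+-monoˡ-≤ (#≥ k Y) (#≥-above-procP γ (length≡ E))) shifted-below

  Envelope-step : ∀ {A B} → Envelope A B → ∀ γ → Envelope (γ ∷ A) (procP A B γ ∷ B)
  Envelope-step E γ = record
    { denser = step-denser ; below = step-below ; tight = step-tight ; length≡ = cong suc (length≡ E) }
    where open EnvelopeStep E γ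

  Envelope-phase2 : ∀ ws {A B} → Envelope A B →
                    ∀ i → Envelope (A ++ take i ws) (B ++ take i (phase2 A B ws))
  Envelope-phase2 ws       {A} {B} E zero    =
    Envelope-resp-↭ (↭-sym (++-identityʳ A)) (↭-sym (++-identityʳ B)) E
  Envelope-phase2 []       E (suc i) = Envelope-phase2 [] E zero
  Envelope-phase2 (γ ∷ ws) {A} {B} E (suc i) =
    Envelope-resp-↭ (↭-sym (shift γ A _)) (↭-sym (shift (procP A B γ) B _))
      (Envelope-phase2 ws (Envelope-step E γ) i)

-- The greedy phase

module _ (Y : List ℕ) where

  TightFrom : List ℕ → List ℕ → ℕ → Set
  TightFrom prev W k = #≥ k (Y ∖ prev) ≡ 0 ⊎ ∃[ l ] k ≤ l × #≥ l Y ≡ #≥ l W + #≥ k (Y ∖ prev)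

  -- prev: the values chosen so far (latest first); W: the letters of w used so far; ws: the
  -- remaining letters among w₁…w_p.  `below` and `tight` say that #≥ k (Y ∖ prev) is the larger
  -- of 0 and max_{l ≥ k} (#≥ l Y − #≥ l W).
  record Phase1Invariant (prev W ws : List ℕ) : Set where
    field
      split     : ∀ k → #≥ k prev + #≥ k (Y ∖ prev) ≡ #≥ k Y
      below     : ∀ {k l} → k ≤ l → #≥ l Y ≤ #≥ l W + #≥ k (Y ∖ prev)
      tight     : ∀ k → TightFrom prev W k
      remaining : length (Y ∖ prev) ≡ length ws
      feasible  : ∀ k → #≥ k Y ≤ #≥ k W + #≥ k ws

  record Greatest (W S : List ℕ) : Set where
    field
      bounded  : S ≤# W
      within   : S ≤# Y
      greatest : ∀ {V U} → V ++ U ↭ Y → V ≤# W → V ≤# S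

open Phase1Invariant
open Greatest

module _ {Y : List ℕ} where

  Phase1Invariant⇒Greatest : ∀ {prev W ws} → Phase1Invariant Y prev W ws → Greatest Y W prev
  Phase1Invariant⇒Greatest {prev} {W} I = record
    { bounded  = λ k → +-cancelʳ-≤ (#≥ k R) _ _
                   (subst (_≤ #≥ k W + #≥ k R) (sym (split I k)) (below I (≤-refl {k})))
    ; within   = λ k → subst (#≥ k prev ≤_) (split I k) (m≤m+n _ _)
    ; greatest = λ {V} {U} → prev-greatest {V} {U}
    }
    where
    R = Y ∖ prev
    prev-greatest : ∀ {V U} → V ++ U ↭ Y → V ≤# W → V ≤# prev
    prev-greatest {V} {U} V++U↭Y V≤W k =
      +-cancelʳ-≤ (#≥ k R) _ _ (subst (#≥ k V + #≥ k R ≤_) (sym (split I k)) V+R≤Y)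
      where
      V+U≡Y : ∀ k → #≥ k V + #≥ k U ≡ #≥ k Y
      V+U≡Y k = ≡.trans (sym (#≥-++ k V U)) (#≥-↭ k V++U↭Y)
      V+R≤Y : #≥ k V + #≥ k R ≤ #≥ k Y
      V+R≤Y with tight I k
      ... | inj₁ none = subst₂ _≤_ (cong (#≥ k V +_) (sym none)) (V+U≡Y k) (+-mono-≤ ≤-refl z≤n)
      ... | inj₂ (l , k≤l , eq) = +-cancelʳ-≤ (#≥ l V) _ _ (begin
        #≥ k V + #≥ k R + #≥ l V              ≡⟨ swap-inner (#≥ k V) (#≥ k R) (#≥ l V) ⟩
        #≥ k V + (#≥ l V + #≥ k R)            ≤⟨ +-monoʳ-≤ (#≥ k V) (+-monoˡ-≤ (#≥ k R) (V≤W l)) ⟩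
        #≥ k V + (#≥ l W + #≥ k R)            ≡⟨ cong (#≥ k V +_) (sym eq) ⟩
        #≥ k V + #≥ l Y                       ≡⟨ cong (#≥ k V +_) (sym (V+U≡Y l)) ⟩
        #≥ k V + (#≥ l V + #≥ l U)            ≤⟨ +-monoʳ-≤ (#≥ k V) (+-monoʳ-≤ (#≥ l V) (#≥-antitone U k≤l)) ⟩
        #≥ k V + (#≥ l V + #≥ k U)            ≡⟨ swap-outer (#≥ k V) (#≥ l V) (#≥ k U) ⟩
        (#≥ k V + #≥ k U) + #≥ l V            ≡⟨ cong (_+ #≥ l V) (V+U≡Y k) ⟩
        #≥ k Y + #≥ l V                       ∎)
        where
        open ≤-Reasoning
        swap-inner : ∀ a b c → a + b + c ≡ a + (c + b)
        swap-inner = solve-∀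
        swap-outer : ∀ a b c → a + (b + c) ≡ (a + c) + b
        swap-outer = solve-∀

  Greatest-resp-↭ : ∀ {W W′ S S′} → W ↭ W′ → S ↭ S′ → Greatest Y W S → Greatest Y W′ S′
  Greatest-resp-↭ {W} {W′} {S} {S′} W↭W′ S↭S′ G = record
    { bounded  = λ k → subst₂ _≤_ (#≥-↭ k S↭S′) (#≥-↭ k W↭W′) (bounded G k)
    ; within   = λ k → subst (_≤ #≥ k Y) (#≥-↭ k S↭S′) (within G k)
    ; greatest = λ {V} {U} V++U↭Y V≤W′ k → subst (#≥ k V ≤_) (#≥-↭ k S↭S′)
                   (greatest G {V} {U} V++U↭Y (λ k → subst (#≥ k V ≤_) (sym (#≥-↭ k W↭W′)) (V≤W′ k)) k)
    }

  Phase1Invariant-base : ∀ {W} → length W ≡ length Y → Y ≤# W → Phase1Invariant Y [] [] W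
  Phase1Invariant-base {W} len Y≤W = record
    { split     = λ k → cong (#≥ k) (∖-[] Y)
    ; below     = λ {k} {l} k≤l → subst (λ R → #≥ l Y ≤ #≥ k R) (sym (∖-[] Y)) (#≥-antitone Y k≤l)
    ; tight     = λ k → inj₂ (k , ≤-refl , cong (#≥ k) (sym (∖-[] Y)))
    ; remaining = ≡.trans (cong length (∖-[] Y)) (sym len)
    ; feasible  = Y≤W
    }

module _ {Y : List ℕ} (Y-unique : Unique Y) (Y-positive : All (1 ≤_) Y) where

  module Phase1Step {prev W x ws} (I : Phase1Invariant Y prev W (x ∷ ws)) where

    private
      R  = Y ∖ prev
      s  = maxLE x R
      R′ = Y ∖ (s ∷ prev)

    #≥-one-R : #≥ 1 R ≡ length R
    #≥-one-R = #≥-one (filter⁺ _ Y-positive)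

    -- If every remaining element of Y exceeded x, the letters ws could not dominate them.
    not-all-above : #≥ (suc x) R ≢ length R
    not-all-above all-above with tight I (suc x)
    ... | inj₁ none = 0≢1+n (≡.trans (sym none) (≡.trans all-above (remaining I)))
    ... | inj₂ (l , x<l , eq) = contradiction (begin
      #≥ l W + suc (length ws)        ≡⟨ cong (#≥ l W +_) (sym (≡.trans all-above (remaining I))) ⟩
      #≥ l W + #≥ (suc x) R           ≡⟨ sym eq ⟩
      #≥ l Y                          ≤⟨ feasible I l ⟩
      #≥ l W + (χ≥ l x + #≥ l ws)     ≡⟨ cong (λ t → #≥ l W + (t + #≥ l ws)) (χ≥-> x<l) ⟩
      #≥ l W + #≥ l ws                ≤⟨ +-monoʳ-≤ (#≥ l W) (#≥≤length l ws) ⟩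
      #≥ l W + length ws              ∎) (<⇒≱ (+-monoʳ-< (#≥ l W) ≤-refl))
      where open ≤-Reasoning

    maxLE-found : s ∈ R × s ≤ x
    maxLE-found with maxLE-cases x R
    ... | inj₂ found = found
    ... | inj₁ s≡0 = contradiction (≡.trans (sym (#≥-constant-above R x 0 nothing-below 1 ≤-refl (s≤s z≤n)))
                                             #≥-one-R) not-all-above
      where
      nothing-below : ∀ {y} → y ∈ R → y ≤ x → y ≤ 0
      nothing-below y∈R y≤x = subst (_ ≤_) s≡0 (maxLE-greatest x R y∈R y≤x)

    private
      s∈R = proj₁ maxLE-found
      s≤x = proj₂ maxLE-found

    #≥-R : ∀ k → #≥ k R ≡ χ≥ k s + #≥ k R′
    #≥-R k = #≥-↭ k (∖-∷-↭ Y-unique prev s∈R)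

    #≥-R-≤ : ∀ {k} → k ≤ s → #≥ k R ≡ suc (#≥ k R′)
    #≥-R-≤ {k} k≤s = ≡.trans (#≥-R k) (cong (_+ #≥ k R′) (χ≥-≤ k≤s))

    #≥-R-> : ∀ {k} → s < k → #≥ k R ≡ #≥ k R′
    #≥-R-> {k} s<k = ≡.trans (#≥-R k) (cong (_+ #≥ k R′) (χ≥-> s<k))

    R-gap : ∀ k → s < k → k ≤ suc x → #≥ k R ≡ #≥ (suc x) R
    R-gap = #≥-constant-above R x s (maxLE-greatest x R)

    step-split : ∀ k → #≥ k (s ∷ prev) + #≥ k R′ ≡ #≥ k Y
    step-split k = begin
      (χ≥ k s + #≥ k prev) + #≥ k R′ ≡⟨ +-assoc (χ≥ k s) _ _ ⟩
      χ≥ k s + (#≥ k prev + #≥ k R′) ≡⟨ +-comm (χ≥ k s) _ ⟩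
      (#≥ k prev + #≥ k R′) + χ≥ k s ≡⟨ +-assoc (#≥ k prev) _ _ ⟩
      #≥ k prev + (#≥ k R′ + χ≥ k s) ≡⟨ cong (#≥ k prev +_) (≡.trans (+-comm (#≥ k R′) _) (sym (#≥-R k))) ⟩
      #≥ k prev + #≥ k R             ≡⟨ split I k ⟩
      #≥ k Y                         ∎
      where open ≡.≡-Reasoning

    step-remaining : length R′ ≡ length ws
    step-remaining = suc-injective (≡.trans (sym (↭-length (∖-∷-↭ Y-unique prev s∈R))) (remaining I))

    step-feasible : ∀ k → #≥ k Y ≤ #≥ k (x ∷ W) + #≥ k ws
    step-feasible k = subst (#≥ k Y ≤_) (move-left (#≥ k W) (χ≥ k x) (#≥ k ws)) (feasible I k)
      where
      move-left : ∀ a b c → a + (b + c) ≡ (b + a) + c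
      move-left = solve-∀

    step-below : ∀ {k l} → k ≤ l → #≥ l Y ≤ #≥ l (x ∷ W) + #≥ k R′
    step-below {k} {l} k≤l with ≤-<-connex k s
    ... | inj₂ s<k = begin
      #≥ l Y                        ≤⟨ below I k≤l ⟩
      #≥ l W + #≥ k R               ≤⟨ +-monoˡ-≤ (#≥ k R) (m≤n+m (#≥ l W) (χ≥ l x)) ⟩
      (χ≥ l x + #≥ l W) + #≥ k R    ≡⟨ cong (_ +_) (#≥-R-> s<k) ⟩
      (χ≥ l x + #≥ l W) + #≥ k R′   ∎
      where open ≤-Reasoning
    ... | inj₁ k≤s with ≤-<-connex l x
    ...   | inj₁ l≤x = begin
      #≥ l Y                        ≤⟨ below I k≤l ⟩
      #≥ l W + #≥ k R               ≡⟨ cong (#≥ l W +_) (#≥-R-≤ k≤s) ⟩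
      #≥ l W + suc (#≥ k R′)        ≡⟨ +-suc (#≥ l W) _ ⟩
      (1 + #≥ l W) + #≥ k R′        ≡⟨ cong (λ t → (t + #≥ l W) + #≥ k R′) (sym (χ≥-≤ l≤x)) ⟩
      (χ≥ l x + #≥ l W) + #≥ k R′   ∎
      where open ≤-Reasoning
    ...   | inj₂ x<l = begin
      #≥ l Y                        ≤⟨ below I (≤-refl {l}) ⟩
      #≥ l W + #≥ l R               ≤⟨ +-monoʳ-≤ (#≥ l W) R-l≤R′-k ⟩
      #≥ l W + #≥ k R′              ≡⟨ cong (λ t → (t + #≥ l W) + #≥ k R′) (sym (χ≥-> x<l)) ⟩
      (χ≥ l x + #≥ l W) + #≥ k R′   ∎
      where
      open ≤-Reasoning
      R-l≤R′-k : #≥ l R ≤ #≥ k R′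
      R-l≤R′-k = ≤-pred (begin
        suc (#≥ l R)       ≤⟨ s≤s (#≥-antitone R x<l) ⟩
        suc (#≥ (suc x) R) ≡⟨ cong suc (sym (R-gap (suc s) ≤-refl (s≤s s≤x))) ⟩
        suc (#≥ (suc s) R) ≤⟨ #≥-∈ s∈R ⟩
        #≥ s R             ≤⟨ #≥-antitone R k≤s ⟩
        #≥ k R             ≡⟨ #≥-R-≤ k≤s ⟩
        suc (#≥ k R′)      ∎)

    tight-above-x : ∀ {k m} → k ≤ m → x < m → #≥ m R ≡ #≥ k R′ → TightFrom Y (s ∷ prev) (x ∷ W) k
    tight-above-x {k} {m} k≤m x<m R≡ with tight I m
    ... | inj₁ none = inj₁ (≡.trans (sym R≡) none)
    ... | inj₂ (l , m≤l , eq) = inj₂ (l , ≤-trans k≤m m≤l ,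
          ≡.trans eq (cong₂ _+_ (cong (_+ #≥ l W) (sym (χ≥-> (<-≤-trans x<m m≤l)))) R≡))

    step-tight : ∀ k → TightFrom Y (s ∷ prev) (x ∷ W) k
    step-tight k with ≤-<-connex k s
    ... | inj₂ s<k with ≤-<-connex k x
    ...   | inj₂ x<k = tight-above-x ≤-refl x<k (#≥-R-> s<k)
    ...   | inj₁ k≤x = tight-above-x (m≤n⇒m≤1+n k≤x) ≤-refl
                         (≡.trans (sym (R-gap k s<k (m≤n⇒m≤1+n k≤x))) (#≥-R-> s<k))
    step-tight k | inj₁ k≤s with tight I k
    ... | inj₁ none = contradiction (≡.trans (sym (#≥-R-≤ k≤s)) none) 1+n≢0
    ... | inj₂ (l , k≤l , eq) with ≤-<-connex l x
    ...   | inj₁ l≤x = inj₂ (l , k≤l , ≡.trans eq (begin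
      #≥ l W + #≥ k R               ≡⟨ cong (#≥ l W +_) (#≥-R-≤ k≤s) ⟩
      #≥ l W + suc (#≥ k R′)        ≡⟨ +-suc (#≥ l W) _ ⟩
      (1 + #≥ l W) + #≥ k R′        ≡⟨ cong (λ t → (t + #≥ l W) + #≥ k R′) (sym (χ≥-≤ l≤x)) ⟩
      (χ≥ l x + #≥ l W) + #≥ k R′   ∎))
      where open ≡.≡-Reasoning
    ...   | inj₂ x<l = contradiction (step-below k≤l) (<⇒≱ (begin-strict
      (χ≥ l x + #≥ l W) + #≥ k R′   ≡⟨ cong (λ t → (t + #≥ l W) + #≥ k R′) (χ≥-> x<l) ⟩
      #≥ l W + #≥ k R′              <⟨ +-monoʳ-< (#≥ l W) ≤-refl ⟩
      #≥ l W + suc (#≥ k R′)        ≡⟨ cong (#≥ l W +_) (sym (#≥-R-≤ k≤s)) ⟩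
      #≥ l W + #≥ k R               ≡⟨ sym eq ⟩
      #≥ l Y                        ∎))
      where open ≤-Reasoning

  Phase1Invariant-step : ∀ {prev W x ws} → (I : Phase1Invariant Y prev W (x ∷ ws)) →
                         Phase1Invariant Y (maxLE x (Y ∖ prev) ∷ prev) (x ∷ W) ws
  Phase1Invariant-step I = record
    { split = step-split ; below = step-below ; tight = step-tight
    ; remaining = step-remaining ; feasible = step-feasible }
    where open Phase1Step I

  Greatest-phase1 : ∀ ws {prev W} → Phase1Invariant Y prev W ws →
                    ∀ i → Greatest Y (W ++ take i ws) (prev ++ take i (phase1 Y ws prev))
  Greatest-phase1 ws       {prev} {W} I zero    =
    Greatest-resp-↭ (↭-sym (++-identityʳ W)) (↭-sym (++-identityʳ prev)) (Phase1Invariant⇒Greatest I)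
  Greatest-phase1 []       I (suc i) = Greatest-phase1 [] I zero
  Greatest-phase1 (x ∷ ws) {prev} {W} I (suc i) =
    Greatest-resp-↭ (↭-sym (shift x W _)) (↭-sym (shift (maxLE x (Y ∖ prev)) prev _))
      (Greatest-phase1 ws (Phase1Invariant-step I) i)

-- The maximal lift

oneTo-denser : ∀ {n Y} → Unique Y → All (λ y → 1 ≤ y × y ≤ n) Y → Denser Y (oneTo n)
oneTo-denser {n} {Y} Y-unique Y-range = Denser-steps Y {oneTo n} step
  where
  step : ∀ j → #≥ (suc j) (oneTo n) + #≥ j Y ≤ #≥ j (oneTo n) + #≥ (suc j) Y
  step j with j ∈? Y
  ... | no j∉Y rewrite #≥-∉ j∉Y = +-monoˡ-≤ (#≥ (suc j) Y) (#≥-antitone (oneTo n) (n≤1+n j))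
  ... | yes j∈Y with All.lookup Y-range j∈Y
  ...   | s≤s {n = i} z≤n , j≤n = begin
    #≥ (2 + i) (oneTo n) + #≥ (suc i) Y     ≡⟨ cong (_+ #≥ (suc i) Y) (#≥-oneTo (suc i) n) ⟩
    n ∸ suc i + #≥ (suc i) Y                ≤⟨ +-monoʳ-≤ (n ∸ suc i) (#≥-unique Y-unique (suc i)) ⟩
    n ∸ suc i + suc (#≥ (2 + i) Y)          ≡⟨ +-suc (n ∸ suc i) _ ⟩
    suc (n ∸ suc i) + #≥ (2 + i) Y          ≡⟨ cong (_+ #≥ (2 + i) Y) (sym (+-∸-assoc 1 j≤n)) ⟩
    n ∸ i + #≥ (2 + i) Y                    ≡⟨ cong (_+ #≥ (2 + i) Y) (sym (#≥-oneTo i n)) ⟩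
    #≥ (suc i) (oneTo n) + #≥ (2 + i) Y     ∎
    where open ≤-Reasoning

take-++ˡ : ∀ {A : Set} i (xs ys : List A) → i ≤ length xs → take i (xs ++ ys) ≡ take i xs
take-++ˡ zero    xs       ys _         = ≡.refl
take-++ˡ (suc i) (x ∷ xs) ys (s≤s i≤) = cong (x ∷_) (take-++ˡ i xs ys i≤)

take-++ʳ : ∀ {A : Set} j (xs ys : List A) → take (length xs + j) (xs ++ ys) ≡ xs ++ take j ys
take-++ʳ j []       ys = ≡.refl
take-++ʳ j (x ∷ xs) ys = cong (x ∷_) (take-++ʳ j xs ys)

take-+ : ∀ {A : Set} p j (xs : List A) → take (p + j) xs ≡ take p xs ++ take j (drop p xs)
take-+ zero    j xs       = ≡.refl
take-+ (suc p) j []       = sym (take-[] j)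
take-+ (suc p) j (x ∷ xs) = cong (x ∷_) (take-+ p j xs)

take-take-≤ : ∀ {A : Set} {i p} (xs : List A) → i ≤ p → take i (take p xs) ≡ take i xs
take-take-≤ {i = i} {p} xs i≤p = ≡.trans (take-take i p xs) (cong (λ m → take m xs) (m≤n⇒m⊓n≡m i≤p))

length-take-cong : ∀ {A : Set} i {xs ys : List A} → length xs ≡ length ys →
                   length (take i xs) ≡ length (take i ys)
length-take-cong i {xs} {ys} len =
  ≡.trans (length-take i xs) (≡.trans (cong (i ⊓_) len) (sym (length-take i ys)))

module MaximalLift {n p : ℕ} {Y w : List ℕ} (p≤n : p ≤ n) (Y-unique : Unique Y) (|Y|≡p : length Y ≡ p)
                   (Y-range : All (λ y → 1 ≤ y × y ≤ n) Y) (w-perm : IsPerm n w) (Y≤w : Y ≤ₛ take p w) where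

  private
    W  = take p w
    ws = drop p w
    σ₁ = phase1 Y W []
    σ₂ = phase2 W Y ws
    σ  = maxLift p Y w

  length-perm : ∀ {v} → IsPerm n v → length v ≡ n
  length-perm v-perm = ≡.trans (↭-length v-perm) (≡.trans (length-map suc (upTo n)) (length-upTo n))

  |W| : length W ≡ p
  |W| = ≡.trans (length-take p w) (m≤n⇒m⊓n≡m (subst (p ≤_) (sym (length-perm w-perm)) p≤n))

  |σ₁| : length σ₁ ≡ p
  |σ₁| = ≡.trans (length-phase1 W []) |W|
    where
    length-phase1 : ∀ xs prev → length (phase1 Y xs prev) ≡ length xs
    length-phase1 []       prev = ≡.refl
    length-phase1 (x ∷ xs) prev = cong suc (length-phase1 xs _)

  |σ| : length σ ≡ n
  |σ| = begin
    length (σ₁ ++ σ₂)          ≡⟨ length-++ σ₁ ⟩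
    length σ₁ + length σ₂      ≡⟨ cong₂ _+_ |σ₁| (≡.trans (length-phase2 W Y ws) (length-drop p w)) ⟩
    p + (length w ∸ p)         ≡⟨ cong (λ m → p + (m ∸ p)) (length-perm w-perm) ⟩
    p + (n ∸ p)                ≡⟨ m+[n∸m]≡n p≤n ⟩
    n                          ∎
    where
    open ≡.≡-Reasoning
    length-phase2 : ∀ A B xs → length (phase2 A B xs) ≡ length xs
    length-phase2 A B []       = ≡.refl
    length-phase2 A B (x ∷ xs) = cong suc (length-phase2 _ _ xs)

  Y≤#W : Y ≤# W
  Y≤#W = ≤ₛ⇒≤# Y≤w

  greedy : ∀ i → Greatest Y (take i W) (take i σ₁)
  greedy = Greatest-phase1 Y-unique (All.map proj₁ Y-range) W
             (Phase1Invariant-base (≡.trans |W| (sym |Y|≡p)) Y≤#W)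

  envelope : ∀ j → Envelope Y (W ++ take j ws) (Y ++ take j σ₂)
  envelope = Envelope-phase2 Y ws (Envelope-base Y (≡.trans |Y|≡p (sym |W|)) Y≤#W)

  σ₁↭Y : σ₁ ↭ Y
  σ₁↭Y = #≥-≡⇒↭ (λ k → ≤-antisym (within G k) (greatest G {Y} {[]} (++-identityʳ Y) Y≤#W k))
    where
    G : Greatest Y W σ₁
    G = subst₂ (Greatest Y) (take-all p W (≤-reflexive |W|)) (take-all p σ₁ (≤-reflexive |σ₁|)) (greedy p)

  prefix-low : ∀ {i} → i ≤ p → take i σ ≡ take i σ₁
  prefix-low {i} i≤p = take-++ˡ i σ₁ σ₂ (subst (i ≤_) (sym |σ₁|) i≤p)

  prefix-high : ∀ j → take (p + j) σ ↭ Y ++ take j σ₂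
  prefix-high j = subst (λ m → take (m + j) σ ↭ Y ++ take j σ₂) |σ₁|
    (↭-trans (↭-reflexive (take-++ʳ j σ₁ σ₂)) (++⁺ʳ (take j σ₂) σ₁↭Y))

  σ-below-w : ∀ i → take i σ ≤# take i w
  σ-below-w i with ≤-total i p
  ... | inj₁ i≤p rewrite prefix-low i≤p | sym (take-take-≤ w i≤p) = bounded (greedy i)
  ... | inj₂ p≤i = subst (λ m → take m σ ≤# take m w) (m+[n∸m]≡n p≤i) (high (i ∸ p))
    where
    high : ∀ j → take (p + j) σ ≤# take (p + j) w
    high j rewrite take-+ p j w = λ k → ≤-trans (↭⇒≤# (prefix-high j) k) (Envelope⇒≤# Y (envelope j) k)

  σ-greatest-high : ∀ j {V} → Denser Y V → V ≤# take (p + j) w → V ≤# take (p + j) σ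
  σ-greatest-high j {V} V-denser V≤w rewrite take-+ p j w = λ k →
    ≤-trans (Envelope-maximal Y {V = V} (envelope j) V-denser V≤w k) (↭⇒≤# (↭-sym (prefix-high j)) k)

  σ-greatest : ∀ {v} → take p v ↭ Y → ∀ i → take i v ≤# take i w → take i v ≤# take i σ
  σ-greatest {v} v-prefix i v≤w with ≤-total i p
  ... | inj₁ i≤p rewrite prefix-low i≤p | sym (take-take-≤ w i≤p) =
    greatest (greedy i) {take i v} (≡.subst (_↭ Y) split-prefix v-prefix) v≤w
    where
    split-prefix : take p v ≡ take i v ++ drop i (take p v)
    split-prefix = ≡.trans (sym (take++drop≡id i (take p v)))
                           (cong (_++ drop i (take p v)) (take-take-≤ v i≤p))
  ... | inj₂ p≤i rewrite sym (m+[n∸m]≡n p≤i) = σ-greatest-high (i ∸ p) {take (p + (i ∸ p)) v} v-denser v≤w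
    where
    v-denser : Denser Y (take (p + (i ∸ p)) v)
    v-denser rewrite take-+ p (i ∸ p) v = Denser-⊇ Y {take p v ++ take (i ∸ p) (drop p v)} (++⁺ʳ _ v-prefix)

  take-whole : ∀ {v : List ℕ} → length v ≡ n → take (p + (n ∸ p)) v ≡ v
  take-whole {v} len = ≡.trans (cong (λ m → take m v) (m+[n∸m]≡n p≤n)) (take-all n v (≤-reflexive len))

  σ-prefix : take p σ ↭ Y
  σ-prefix = subst (_↭ Y) (sym (≡.trans (prefix-low ≤-refl) (take-all p σ₁ (≤-reflexive |σ₁|)))) σ₁↭Y

  σ-bruhat : BruhatLE n σ w
  σ-bruhat i _ _ = ≤#⇒≤ₛ (length-take-cong i (≡.trans |σ| (sym (length-perm w-perm)))) (σ-below-w i)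

  σ-perm : IsPerm n σ
  σ-perm = ↭-trans (#≥-≡⇒↭ (λ k → ≤-antisym (σ≤w k) (w≤σ k))) w-perm
    where
    σ≤w : σ ≤# w
    σ≤w = subst₂ _≤#_ (take-whole {σ} |σ|) (take-whole {w} (length-perm w-perm)) (σ-below-w (p + (n ∸ p)))
    w-denser : Denser Y w
    w-denser = Denser-resp-↭ Y (↭-sym w-perm) (oneTo-denser Y-unique Y-range)
    w≤σ : w ≤# σ
    w≤σ = subst (w ≤#_) (take-whole {σ} |σ|) (σ-greatest-high (n ∸ p) {w} w-denser
            (↭⇒≤# (↭-reflexive (sym (take-whole {w} (length-perm w-perm))))))

  σ-maximal : ∀ {v} → IsPerm n v → take p v ↭ Y → BruhatLE n v w → BruhatLE n v σ
  σ-maximal v-perm v-prefix v≤w i 1≤i i≤n =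
    ≤#⇒≤ₛ (length-take-cong i (≡.trans (length-perm v-perm) (sym |σ|)))
          (σ-greatest v-prefix i (≤ₛ⇒≤# (v≤w i 1≤i i≤n)))

proposition5p1 : (n p : ℕ) (Y w : List ℕ) →
    1 ≤ p → p ≤ n →
    Unique Y → length Y ≡ p → All (λ y → 1 ≤ y × y ≤ n) Y →
    IsPerm n w → Y ≤ₛ take p w →
    (IsPerm n (maxLift p Y w) ×
     (take p (maxLift p Y w) ↭ Y × BruhatLE n (maxLift p Y w) w) ×
     ((v : List ℕ) → IsPerm n v → take p v ↭ Y →
        ¬ BruhatLE n v (maxLift p Y w) → ¬ BruhatLE n v w))
proposition5p1 n p Y w _ p≤n Y-unique |Y|≡p Y-range w-perm Y≤w =
  σ-perm , (σ-prefix , σ-bruhat) , λ v v-perm v-prefix v≰σ v≤w → v≰σ (σ-maximal v-perm v-prefix v≤w)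
  where open MaximalLift p≤n Y-unique |Y|≡p Y-range w-perm Y≤w
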